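{- Let $p$ and $a$ be positive integers with $\gcd(a,p)=1$, and let $r\ge 0$, $m\ge 1$ and $v$ with $1\le v\le p$ be integers. Let $b_{v,r,a,m}(n)$ denote the number of partitions of $n$ in which every multiplicity $\mu$ of a part satisfies: $\mu\equiv ja\pmod p$ for some $j\in\{0,1,\ldots,v-1\}$ and $j(pr+a)\le\mu\le j(pr+a)+p(m-1)$. Set $b_{v,r,a,m}(0)=1$ and $b_{v,r,a,m}(k)=0$ for $k<0$. If $n$ is a non-negative integer with $\gcd(v,p)\nmid n$, then $$b_{v,r,a,m}(n)=\sum_{j=1}^{n}(-1)^{j+1}\left(b_{v,r,a,m}\!\left(n-\tfrac{(pr+a)j(3j-1)}{2}\right)+b_{v,r,a,m}\!\left(n-\tfrac{(pr+a)j(3j+1)}{2}\right)\right).$$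
   Context: A partition of $n$ is a finite multiset of positive integers (parts) summing to $n$; the multiplicity of a part is the number of times it occurs. -}

module Defs where

open import Data.Nat as ℕ using (ℕ; zero; suc; _+_; _*_; _∸_; _≤_; _≤?_; _/_)
import Data.Nat.Divisibility as ℕD
open import Data.Integer as ℤ using (ℤ; +_; -[1+_])
open import Data.Integer.Divisibility as ℤD using ()
open import Data.Fin using (Fin; toℕ)
open import Data.Fin.Properties using (any?)
open import Data.Vec using (Vec; []; _∷_)
open import Data.List as List using (List; []; _∷_; _++_; concatMap; upTo; filter; length; map)
open import Data.Product using (Σ; _×_; _,_)
open import Data.Sum using (_⊎_)
open import Relation.Nullary using (Dec; yes; no; ¬_)
open import Relation.Nullary.Decidable using (_×-dec_; _⊎-dec_)
open import Relation.Binary.PropositionalEquality using (_≡_)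

_≡_[mod_] : ℕ → ℕ → ℕ → Set
x ≡ y [mod p ] = (+ p) ℤD.∣ ((+ x) ℤ.- (+ y))

AllowedMult : (p v r a m : ℕ) → ℕ → Set
AllowedMult p v r a m μ =
  Σ (Fin v) λ j →
    (μ ≡ toℕ j * a [mod p ]) ×
    (toℕ j * (p * r + a) ≤ μ) ×
    (μ ≤ toℕ j * (p * r + a) + p * (m ∸ 1))

allowedMult? : (p v r a m μ : ℕ) → Dec (AllowedMult p v r a m μ)
allowedMult? p v r a m μ =
  any? λ j → (p ℕD.∣? ℤ.∣ (+ μ) ℤ.- (+ (toℕ j * a)) ∣)
             ×-dec (toℕ j * (p * r + a) ≤? μ)
             ×-dec (μ ≤? toℕ j * (p * r + a) + p * (m ∸ 1))

-- Partitions, represented as multisets of positive integers via their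
-- multiplicity vectors.  A partition of n has all parts in {1,…,n}, so it
-- is a vector (μ₁,…,μₙ) of multiplicities; part i occurs μᵢ times.
-- weight k v = Σ_{i=1}^{k} i·μᵢ  for v = (μ₁,…,μ_k) (stored with μ_k first).

multVecs : (k n : ℕ) → List (Vec ℕ k)
multVecs zero zero = [] ∷ []
multVecs zero (suc n) = []
multVecs (suc k) n =
  concatMap (λ μ → map (μ ∷_) (multVecs k (n ∸ suc k * μ)))
            (filter (λ μ → suc k * μ ≤? n) (upTo (suc n)))

data AllMultsOK (P : ℕ → Set) : {k : ℕ} → Vec ℕ k → Set where
  []    : AllMultsOK P []
  zero∷ : ∀ {k} {μs : Vec ℕ k} → AllMultsOK P μs → AllMultsOK P (0 ∷ μs)
  ok∷   : ∀ {k μ} {μs : Vec ℕ k} → P (suc μ) → AllMultsOK P μs → AllMultsOK P (suc μ ∷ μs)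

allMultsOK? : {P : ℕ → Set} → ((μ : ℕ) → Dec (P μ)) → {k : ℕ} → (μs : Vec ℕ k) → Dec (AllMultsOK P μs)
allMultsOK? P? [] = yes []
allMultsOK? P? (zero ∷ μs) with allMultsOK? P? μs
... | yes q = yes (zero∷ q)
... | no ¬q = no λ { (zero∷ q) → ¬q q }
allMultsOK? P? (suc μ ∷ μs) with P? (suc μ) | allMultsOK? P? μs
... | yes h | yes q = yes (ok∷ h q)
... | no ¬h | _ = no λ { (ok∷ h q) → ¬h h }
... | yes _ | no ¬q = no λ { (ok∷ h q) → ¬q q }

-- b_{v,r,a,m}(n) for n ≥ 0 (p is the additional fixed parameter).
-- For n = 0 the only partition is the empty one, so b(0) = 1 automatically.
b : (p v r a m n : ℕ) → ℕ
b p v r a m n =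
  length (filter (allMultsOK? (allowedMult? p v r a m)) (multVecs n n))

bℤ : (p v r a m : ℕ) → ℤ → ℕ
bℤ p v r a m (+ n) = b p v r a m n
bℤ p v r a m -[1+ _ ] = 0

-- Generalised pentagonal numbers j(3j-1)/2 and j(3j+1)/2 (always integers).
pentMinus pentPlus : ℕ → ℕ
pentMinus j = (j * (3 * j ∸ 1)) / 2
pentPlus  j = (j * (3 * j + 1)) / 2

sumFrom1 : ℕ → (ℕ → ℤ) → ℤ
sumFrom1 zero f = + 0
sumFrom1 (suc n) f = sumFrom1 n f ℤ.+ f (suc n)

sign : ℕ → ℤ
sign zero = + 1
sign (suc e) = ℤ.- sign e

module Submission where

-- With c = pr + a and w the indicator of the allowed multiplicities, b has generating function
-- ∏_{k≥1} W(q^k) where W = ∑ w μ q^μ.  Since c ≡ a (mod p), shifting an allowed multiplicity by c moves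
-- its index j to j + 1; this fails only at j = 0 (going down) or j = v - 1 (going up), where the
-- multiplicity is ≡ 0 resp. ≡ v·a (mod p), hence divisible by g = gcd(v,p).  So the coefficients of
-- (1 - q^c) W(q) vanish off the multiples of g, and then so do those of ∏_k (1 - q^{ck}) W(q^k).
-- For g ∤ n the n-th coefficient of (q^c; q^c)_n · ∑ b(k) q^k is therefore 0, and expanding
-- (q^c; q^c)_n by Shanks' finite form of Euler's pentagonal theorem yields the recurrence.

open import Defs
open import Data.Nat using (ℕ; _≤_; _<_; suc) renaming (_*_ to _*ℕ_; _+_ to _+ℕ_)
open import Data.Nat.GCD using (gcd; gcd[m,n]∣m; gcd[m,n]∣n)
open import Data.Nat.Divisibility using (_∣_; _∣?_; _∣0; ∣-trans; ∣n⇒∣m*n; ∣m∸n∣n⇒∣m)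
open import Data.Integer as ℤ using (ℤ; +_)
open import Relation.Nullary using (¬_; Dec; yes; no)
open import Relation.Binary.PropositionalEquality
  using (_≡_; refl; sym; trans; cong; cong₂; subst; _≗_; module ≡-Reasoning)

open import Data.Nat using (zero; _+_; _*_; _∸_; _/_; z≤n; s≤s; s≤s⁻¹; _≤?_; _<?_; NonZero; >-nonZero)
import Data.Nat.Properties as ℕₚ
open import Data.Nat.DivMod using (m*n/n≡m)
import Data.Nat.Tactic.RingSolver as ℕ-Solver
import Data.Integer.Properties as ℤₚ
import Data.Integer.Divisibility.Signed as ℤ∣
import Data.Integer.Tactic.RingSolver as ℤ-Solver
open import Data.Empty using (⊥-elim)
open import Data.Product using (Σ; _,_; _×_)
open import Data.Fin using (toℕ; fromℕ<)
open import Data.Fin.Properties using (toℕ<n; toℕ-fromℕ<)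
open import Data.List using (List; []; _∷_; _++_; length; filter; map; concatMap; applyUpTo; upTo)
import Data.List.Properties as Listₚ
open import Data.Vec using (Vec; _∷_)
open import Function using (_∘_)
open import Relation.Unary using (Decidable)

*-distribˡ-- : ∀ a b c → a ℤ.* (b ℤ.- c) ≡ a ℤ.* b ℤ.- a ℤ.* c
*-distribˡ-- = ℤ-Solver.solve-∀

*-distribʳ-- : ∀ a b c → (a ℤ.- b) ℤ.* c ≡ a ℤ.* c ℤ.- b ℤ.* c
*-distribʳ-- = ℤ-Solver.solve-∀

-- Power series

Series : Set
Series = ℕ → ℤ

infixl 6 _-ˢ_
infixr 8 q^_·_

_-ˢ_ : Series → Series → Series
(f -ˢ g) x = f x ℤ.- g x

q^_·_ : ℕ → Series → Series
(q^ zero  · f) x       = f x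
(q^ suc s · f) zero    = + 0
(q^ suc s · f) (suc x) = (q^ s · f) x

q^-congᵇ : ∀ s x {f g : Series} → (∀ y → y ≤ x → f y ≡ g y) → (q^ s · f) x ≡ (q^ s · g) x
q^-congᵇ zero    x       f≡g = f≡g x ℕₚ.≤-refl
q^-congᵇ (suc s) zero    f≡g = refl
q^-congᵇ (suc s) (suc x) f≡g = q^-congᵇ s x (λ y y≤x → f≡g y (ℕₚ.m≤n⇒m≤1+n y≤x))

q^-cong : ∀ s {f g} → f ≗ g → q^ s · f ≗ q^ s · g
q^-cong s f≗g x = q^-congᵇ s x (λ y _ → f≗g y)

q^-< : ∀ s x f → x < s → (q^ s · f) x ≡ + 0
q^-< (suc s) zero    f _         = refl
q^-< (suc s) (suc x) f (s≤s x<s) = q^-< s x f x<s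

q^-≤ : ∀ s x f → s ≤ x → (q^ s · f) x ≡ f (x ∸ s)
q^-≤ zero    x       f _         = refl
q^-≤ (suc s) (suc x) f (s≤s s≤x) = q^-≤ s x f s≤x

q^-+ : ∀ s t f → q^ s · q^ t · f ≗ q^ (s + t) · f
q^-+ zero    t f x       = refl
q^-+ (suc s) t f zero    = refl
q^-+ (suc s) t f (suc x) = q^-+ s t f x

q^-comm : ∀ s t f → q^ s · q^ t · f ≗ q^ t · q^ s · f
q^-comm s t f x = begin
  (q^ s · q^ t · f) x  ≡⟨ q^-+ s t f x ⟩
  (q^ (s + t) · f) x   ≡⟨ cong (λ e → (q^ e · f) x) (ℕₚ.+-comm s t) ⟩
  (q^ (t + s) · f) x   ≡⟨ q^-+ t s f x ⟨
  (q^ t · q^ s · f) x  ∎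
  where open ≡-Reasoning

q^-- : ∀ s f g → q^ s · (f -ˢ g) ≗ (q^ s · f) -ˢ (q^ s · g)
q^-- zero    f g x       = refl
q^-- (suc s) f g zero    = refl
q^-- (suc s) f g (suc x) = q^-- s f g x

q^-* : ∀ s z f x → (q^ s · (λ y → z ℤ.* f y)) x ≡ z ℤ.* (q^ s · f) x
q^-* zero    z f x       = refl
q^-* (suc s) z f zero    = sym (ℤₚ.*-zeroʳ z)
q^-* (suc s) z f (suc x) = q^-* s z f x

∑< : ℕ → (ℕ → ℤ) → ℤ
∑< zero    φ = + 0
∑< (suc N) φ = φ 0 ℤ.+ ∑< N (φ ∘ suc)

∑<-cong : ∀ N {φ ψ} → (∀ i → i < N → φ i ≡ ψ i) → ∑< N φ ≡ ∑< N ψ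
∑<-cong zero    φ≡ψ = refl
∑<-cong (suc N) φ≡ψ = cong₂ ℤ._+_ (φ≡ψ 0 (s≤s z≤n)) (∑<-cong N (λ i i<N → φ≡ψ (suc i) (s≤s i<N)))

∑<-zero : ∀ N {φ} → (∀ i → i < N → φ i ≡ + 0) → ∑< N φ ≡ + 0
∑<-zero zero    φ≡0 = refl
∑<-zero (suc N) φ≡0 = cong₂ ℤ._+_ (φ≡0 0 (s≤s z≤n)) (∑<-zero N (λ i i<N → φ≡0 (suc i) (s≤s i<N)))

∑<-- : ∀ N φ ψ → ∑< N (λ i → φ i ℤ.- ψ i) ≡ ∑< N φ ℤ.- ∑< N ψ
∑<-- zero    φ ψ = refl
∑<-- (suc N) φ ψ = begin
  (φ 0 ℤ.- ψ 0) ℤ.+ ∑< N (λ i → φ (suc i) ℤ.- ψ (suc i))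
    ≡⟨ cong (λ t → (φ 0 ℤ.- ψ 0) ℤ.+ t) (∑<-- N (φ ∘ suc) (ψ ∘ suc)) ⟩
  (φ 0 ℤ.- ψ 0) ℤ.+ (∑< N (φ ∘ suc) ℤ.- ∑< N (ψ ∘ suc))
    ≡⟨ interchange (φ 0) (ψ 0) _ _ ⟩
  (φ 0 ℤ.+ ∑< N (φ ∘ suc)) ℤ.- (ψ 0 ℤ.+ ∑< N (ψ ∘ suc)) ∎
  where
  open ≡-Reasoning
  interchange : ∀ a b c d → (a ℤ.- b) ℤ.+ (c ℤ.- d) ≡ (a ℤ.+ c) ℤ.- (b ℤ.+ d)
  interchange = ℤ-Solver.solve-∀

∑<-++ : ∀ M N φ → ∑< (M + N) φ ≡ ∑< M φ ℤ.+ ∑< N (λ i → φ (M + i))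
∑<-++ zero    N φ = sym (ℤₚ.+-identityˡ _)
∑<-++ (suc M) N φ = trans (cong (λ t → φ 0 ℤ.+ t) (∑<-++ M N (φ ∘ suc))) (sym (ℤₚ.+-assoc (φ 0) _ _))

∑<-last : ∀ N φ → ∑< (suc N) φ ≡ ∑< N φ ℤ.+ φ N
∑<-last zero    φ = trans (ℤₚ.+-identityʳ (φ 0)) (sym (ℤₚ.+-identityˡ (φ 0)))
∑<-last (suc N) φ = trans (cong (λ t → φ 0 ℤ.+ t) (∑<-last N (φ ∘ suc))) (sym (ℤₚ.+-assoc (φ 0) _ _))

Δ : (ℕ → ℤ) → ℕ → ℤ
Δ u zero    = u 0
Δ u (suc k) = u (suc k) ℤ.- u k

∑<-telescope : ∀ n u → ∑< (suc n) (Δ u) ≡ u n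
∑<-telescope zero    u = ℤₚ.+-identityʳ (u 0)
∑<-telescope (suc n) u = begin
  ∑< (suc (suc n)) (Δ u)                 ≡⟨ ∑<-last (suc n) (Δ u) ⟩
  ∑< (suc n) (Δ u) ℤ.+ Δ u (suc n)       ≡⟨ cong (λ t → t ℤ.+ Δ u (suc n)) (∑<-telescope n u) ⟩
  u n ℤ.+ (u (suc n) ℤ.- u n)            ≡⟨ cancel (u n) (u (suc n)) ⟩
  u (suc n)                              ∎
  where
  open ≡-Reasoning
  cancel : ∀ a b → a ℤ.+ (b ℤ.- a) ≡ b
  cancel = ℤ-Solver.solve-∀

q^-∑< : ∀ s N (φ : ℕ → Series) x → (q^ s · (λ y → ∑< N (λ μ → φ μ y))) x ≡ ∑< N (λ μ → (q^ s · φ μ) x)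
q^-∑< zero    N φ x       = refl
q^-∑< (suc s) N φ zero    = sym (∑<-zero N (λ _ _ → refl))
q^-∑< (suc s) N φ (suc x) = q^-∑< s N φ x

-- Operators commuting with shifts

record IsShiftLinear (O : Series → Series) : Set where
  field
    ≗-cong  : ∀ {f g} → f ≗ g → O f ≗ O g
    -ˢ-homo : ∀ f g → O (f -ˢ g) ≗ O f -ˢ O g
    q^-homo : ∀ s f → O (q^ s · f) ≗ q^ s · O f

infixr 8 [1-q^_]·_

[1-q^_]·_ : ℕ → Series → Series
[1-q^ s ]· f = f -ˢ (q^ s · f)

id-isShiftLinear : IsShiftLinear (λ f → f)
id-isShiftLinear = record { ≗-cong = λ f≗g → f≗g ; -ˢ-homo = λ _ _ _ → refl ; q^-homo = λ _ _ _ → refl }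

∘-isShiftLinear : ∀ {O P} → IsShiftLinear O → IsShiftLinear P → IsShiftLinear (O ∘ P)
∘-isShiftLinear {O} {P} isO isP = record
  { ≗-cong  = λ f≗g → O.≗-cong (P.≗-cong f≗g)
  ; -ˢ-homo = λ f g x → trans (O.≗-cong (P.-ˢ-homo f g) x) (O.-ˢ-homo (P f) (P g) x)
  ; q^-homo = λ s f x → trans (O.≗-cong (P.q^-homo s f) x) (O.q^-homo s (P f) x)
  }
  where
  module O = IsShiftLinear isO
  module P = IsShiftLinear isP

[1-q^]-isShiftLinear : ∀ s → IsShiftLinear ([1-q^ s ]·_)
[1-q^]-isShiftLinear s = record
  { ≗-cong  = λ f≗g x → cong₂ ℤ._-_ (f≗g x) (q^-cong s f≗g x)
  ; -ˢ-homo = λ f g x → trans (cong (λ t → (f x ℤ.- g x) ℤ.- t) (q^-- s f g x)) (interchange (f x) (g x) _ _)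
  ; q^-homo = λ t f x → trans (cong (λ u → (q^ t · f) x ℤ.- u) (q^-comm s t f x)) (sym (q^-- t f (q^ s · f) x))
  }
  where
  interchange : ∀ a b c d → (a ℤ.- b) ℤ.- (c ℤ.- d) ≡ (a ℤ.- c) ℤ.- (b ℤ.- d)
  interchange = ℤ-Solver.solve-∀

[1-q^]-comm : ∀ {O} → IsShiftLinear O → ∀ s f → O ([1-q^ s ]· f) ≗ [1-q^ s ]· O f
[1-q^]-comm {O} isO s f x =
  trans (-ˢ-homo f (q^ s · f) x) (cong (λ t → O f x ℤ.- t) (q^-homo s f x))
  where open IsShiftLinear isO

q^-[1-q^] : ∀ s t f x → (q^ s · [1-q^ t ]· f) x ≡ (q^ s · f) x ℤ.- (q^ (s + t) · f) x
q^-[1-q^] s t f x = trans (q^-- s f (q^ t · f) x) (cong (λ u → (q^ s · f) x ℤ.- u) (q^-+ s t f x))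

-- Substitution q ↦ q^i

infixr 8 _⟨q^_⟩·_

-- w ⟨q^ i ⟩· f is W(q^i)·f for W = ∑ w μ q^μ; cutting the sum at μ ≤ x is exact only for i ≥ 1.
_⟨q^_⟩·_ : (ℕ → ℤ) → ℕ → Series → Series
(w ⟨q^ i ⟩· f) x = ∑< (suc x) (λ μ → w μ ℤ.* (q^ i * μ · f) x)

dilate-∑< : ∀ w i f x N → suc x ≤ N → ∑< N (λ μ → w μ ℤ.* (q^ suc i * μ · f) x) ≡ (w ⟨q^ suc i ⟩· f) x
dilate-∑< w i f x N 1+x≤N with ℕₚ.m≤n⇒∃[o]m+o≡n 1+x≤N
... | d , refl = begin
  ∑< (suc x + d) φ                                  ≡⟨ ∑<-++ (suc x) d φ ⟩
  (w ⟨q^ suc i ⟩· f) x ℤ.+ ∑< d (λ j → φ (suc x + j)) ≡⟨ cong (λ t → (w ⟨q^ suc i ⟩· f) x ℤ.+ t) (∑<-zero d vanish) ⟩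
  (w ⟨q^ suc i ⟩· f) x ℤ.+ + 0                        ≡⟨ ℤₚ.+-identityʳ _ ⟩
  (w ⟨q^ suc i ⟩· f) x                                ∎
  where
  open ≡-Reasoning
  φ : ℕ → ℤ
  φ μ = w μ ℤ.* (q^ suc i * μ · f) x
  vanish : ∀ j → j < d → φ (suc x + j) ≡ + 0
  vanish j _ = trans (cong (w (suc x + j) ℤ.*_) (q^-< _ x f x<i[x+j]))
                     (ℤₚ.*-zeroʳ (w (suc x + j)))
    where
    x<i[x+j] : x < suc i * (suc x + j)
    x<i[x+j] = ℕₚ.≤-trans (ℕₚ.m≤m+n (suc x) j) (ℕₚ.m≤n*m _ (suc i))

dilate-isShiftLinear : ∀ w i → IsShiftLinear (w ⟨q^ suc i ⟩·_)
dilate-isShiftLinear w i = record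
  { ≗-cong  = λ f≗g x → ∑<-cong (suc x) (λ μ _ → cong (w μ ℤ.*_) (q^-cong (suc i * μ) f≗g x))
  ; -ˢ-homo = λ f g x → trans (∑<-cong (suc x) (λ μ _ → term-homo f g x μ)) (∑<-- (suc x) (term f x) (term g x))
  ; q^-homo = q^-homo
  }
  where
  term : Series → ℕ → ℕ → ℤ
  term f x μ = w μ ℤ.* (q^ suc i * μ · f) x
  term-homo : ∀ f g x μ → w μ ℤ.* (q^ suc i * μ · (f -ˢ g)) x ≡ term f x μ ℤ.- term g x μ
  term-homo f g x μ =
    trans (cong (w μ ℤ.*_) (q^-- (suc i * μ) f g x)) (*-distribˡ-- (w μ) ((q^ suc i * μ · f) x) ((q^ suc i * μ · g) x))
  q^-homo : ∀ s f → w ⟨q^ suc i ⟩· q^ s · f ≗ q^ s · w ⟨q^ suc i ⟩· f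
  q^-homo s f x = begin
    ∑< (suc x) (λ μ → w μ ℤ.* (q^ suc i * μ · q^ s · f) x)
      ≡⟨ ∑<-cong (suc x) (λ μ _ → trans (cong (w μ ℤ.*_) (q^-comm (suc i * μ) s f x)) (sym (q^-* s (w μ) _ x))) ⟩
    ∑< (suc x) (λ μ → (q^ s · (λ y → w μ ℤ.* (q^ suc i * μ · f) y)) x)
      ≡⟨ q^-∑< s (suc x) (λ μ y → w μ ℤ.* (q^ suc i * μ · f) y) x ⟨
    (q^ s · (λ y → ∑< (suc x) (λ μ → w μ ℤ.* (q^ suc i * μ · f) y))) x
      ≡⟨ q^-congᵇ s x (λ y y≤x → dilate-∑< w i f y (suc x) (s≤s y≤x)) ⟩
    (q^ s · w ⟨q^ suc i ⟩· f) x ∎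
    where open ≡-Reasoning

dilate-ˡ- : ∀ u u′ i f → (u -ˢ u′) ⟨q^ i ⟩· f ≗ (u ⟨q^ i ⟩· f) -ˢ (u′ ⟨q^ i ⟩· f)
dilate-ˡ- u u′ i f x =
  trans (∑<-cong (suc x) (λ μ _ → *-distribʳ-- (u μ) (u′ μ) (a μ))) (∑<-- (suc x) (λ μ → u μ ℤ.* a μ) (λ μ → u′ μ ℤ.* a μ))
  where
  a : ℕ → ℤ
  a μ = (q^ i * μ · f) x

dilate-q^ : ∀ w c i f → w ⟨q^ suc i ⟩· q^ c * suc i · f ≗ (q^ c · w) ⟨q^ suc i ⟩· f
dilate-q^ w c i f x = begin
  ∑< (suc x) (λ μ → w μ ℤ.* (q^ suc i * μ · q^ c * suc i · f) x)
    ≡⟨ ∑<-cong (suc x) (λ μ _ → cong₂ ℤ._*_ (sym (w-shifted μ)) (f-shifted μ)) ⟩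
  ∑< (suc x) (λ μ → φ (c + μ))
    ≡⟨ ℤₚ.+-identityˡ _ ⟨
  + 0 ℤ.+ ∑< (suc x) (λ μ → φ (c + μ))
    ≡⟨ cong (λ t → t ℤ.+ ∑< (suc x) (λ μ → φ (c + μ))) (∑<-zero c below) ⟨
  ∑< c φ ℤ.+ ∑< (suc x) (λ μ → φ (c + μ))
    ≡⟨ ∑<-++ c (suc x) φ ⟨
  ∑< (c + suc x) φ
    ≡⟨ dilate-∑< (q^ c · w) i f x (c + suc x) (ℕₚ.m≤n+m (suc x) c) ⟩
  ((q^ c · w) ⟨q^ suc i ⟩· f) x ∎
  where
  open ≡-Reasoning
  φ : ℕ → ℤ
  φ μ = (q^ c · w) μ ℤ.* (q^ suc i * μ · f) x
  w-shifted : ∀ μ → (q^ c · w) (c + μ) ≡ w μ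
  w-shifted μ = trans (q^-≤ c (c + μ) w (ℕₚ.m≤m+n c μ)) (cong w (ℕₚ.m+n∸m≡n c μ))
  f-shifted : ∀ μ → (q^ suc i * μ · q^ c * suc i · f) x ≡ (q^ suc i * (c + μ) · f) x
  f-shifted μ = trans (q^-+ (suc i * μ) (c * suc i) f x) (cong (λ e → (q^ e · f) x) (solve i c μ))
    where
    solve : ∀ i c μ → suc i * μ + c * suc i ≡ suc i * (c + μ)
    solve = ℕ-Solver.solve-∀
  below : ∀ μ → μ < c → φ μ ≡ + 0
  below μ μ<c = trans (cong (ℤ._* (q^ suc i * μ · f) x) (q^-< c μ w μ<c))
                      (ℤₚ.*-zeroˡ ((q^ suc i * μ · f) x))

[1-q^]-dilate : ∀ w c i f → [1-q^ c * suc i ]· w ⟨q^ suc i ⟩· f ≗ ([1-q^ c ]· w) ⟨q^ suc i ⟩· f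
[1-q^]-dilate w c i f x = begin
  Wf ℤ.- (q^ c * suc i · w ⟨q^ suc i ⟩· f) x  ≡⟨ cong (λ t → Wf ℤ.- t) (q^-homo (c * suc i) f x) ⟨
  Wf ℤ.- (w ⟨q^ suc i ⟩· q^ c * suc i · f) x  ≡⟨ cong (λ t → Wf ℤ.- t) (dilate-q^ w c i f x) ⟩
  Wf ℤ.- ((q^ c · w) ⟨q^ suc i ⟩· f) x       ≡⟨ dilate-ˡ- w (q^ c · w) (suc i) f x ⟨
  (([1-q^ c ]· w) ⟨q^ suc i ⟩· f) x          ∎
  where
  open ≡-Reasoning
  open IsShiftLinear (dilate-isShiftLinear w i)
  Wf = (w ⟨q^ suc i ⟩· f) x

SupportedOnMultiplesOf : ℕ → Series → Set
SupportedOnMultiplesOf g f = ∀ x → ¬ g ∣ x → f x ≡ + 0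

q^-supported : ∀ {g f} t → SupportedOnMultiplesOf g f → g ∣ t → SupportedOnMultiplesOf g (q^ t · f)
q^-supported t supp g∣t x g∤x with t ≤? x
... | yes t≤x = trans (q^-≤ t x _ t≤x) (supp (x ∸ t) (g∤x ∘ λ g∣x∸t → ∣m∸n∣n⇒∣m _ t≤x g∣x∸t g∣t))
... | no  t≰x = q^-< t x _ (ℕₚ.≰⇒> t≰x)

dilate-supported : ∀ {g u f} i → SupportedOnMultiplesOf g u → SupportedOnMultiplesOf g f →
  SupportedOnMultiplesOf g (u ⟨q^ i ⟩· f)
dilate-supported {g} {u} {f} i suppᵤ supp x g∤x = ∑<-zero (suc x) term
  where
  term : ∀ μ → μ < suc x → u μ ℤ.* (q^ i * μ · f) x ≡ + 0
  term μ _ with g ∣? μ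
  ... | yes g∣μ = trans (cong (u μ ℤ.*_) (q^-supported (i * μ) supp (∣n⇒∣m*n i g∣μ) x g∤x))
                        (ℤₚ.*-zeroʳ (u μ))
  ... | no  g∤μ = trans (cong (ℤ._* (q^ i * μ · f) x) (suppᵤ μ g∤μ)) (ℤₚ.*-zeroˡ ((q^ i * μ · f) x))

-- Pentagonal numbers

triangle : ℕ → ℕ
triangle zero    = 0
triangle (suc k) = triangle k + suc k

shanksExp : ℕ → ℕ → ℕ
shanksExp m k = m * k + triangle k

shanksExp-zero : ∀ m → shanksExp m 0 ≡ 0
shanksExp-zero m = trans (ℕₚ.+-identityʳ (m * 0)) (ℕₚ.*-zeroʳ m)

shanksExp-suc : ∀ m k → shanksExp m k + k ≡ shanksExp (suc m) k
shanksExp-suc m k = solve m k (triangle k)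
  where
  solve : ∀ m k t → m * k + t + k ≡ suc m * k + t
  solve = ℕ-Solver.solve-∀

shanksExp-boundary : ∀ m k → shanksExp (suc m) k + suc m ≡ shanksExp m (suc k)
shanksExp-boundary m k = solve m k (triangle k)
  where
  solve : ∀ m k t → suc m * k + t + suc m ≡ m * suc k + (t + suc k)
  solve = ℕ-Solver.solve-∀

triangle-double : ∀ k → triangle k * 2 ≡ k * suc k
triangle-double zero    = refl
triangle-double (suc k) = begin
  (triangle k + suc k) * 2       ≡⟨ ℕₚ.*-distribʳ-+ 2 (triangle k) (suc k) ⟩
  triangle k * 2 + suc k * 2     ≡⟨ cong (_+ suc k * 2) (triangle-double k) ⟩
  k * suc k + suc k * 2          ≡⟨ solve k ⟩
  suc k * suc (suc k)            ∎
  where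
  open ≡-Reasoning
  solve : ∀ k → k * suc k + suc k * 2 ≡ suc k * suc (suc k)
  solve = ℕ-Solver.solve-∀

shanksExp-double : ∀ m k → shanksExp m k * 2 ≡ m * k * 2 + k * suc k
shanksExp-double m k =
  trans (ℕₚ.*-distribʳ-+ 2 (m * k) (triangle k)) (cong (λ t → m * k * 2 + t) (triangle-double k))

half : ∀ {n} e → e * 2 ≡ n → n / 2 ≡ e
half e refl = m*n/n≡m e 2

pentPlus≡shanksExp : ∀ j → pentPlus j ≡ shanksExp j j
pentPlus≡shanksExp j = half (shanksExp j j) (trans (shanksExp-double j j) (solve j))
  where
  solve : ∀ j → j * j * 2 + j * suc j ≡ j * (3 * j + 1)
  solve = ℕ-Solver.solve-∀

pentMinus≡shanksExp : ∀ m → pentMinus (suc m) ≡ shanksExp (suc m) m + suc m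
pentMinus≡shanksExp m = half (shanksExp (suc m) m + suc m) (begin
  (shanksExp (suc m) m + suc m) * 2           ≡⟨ ℕₚ.*-distribʳ-+ 2 (shanksExp (suc m) m) (suc m) ⟩
  shanksExp (suc m) m * 2 + suc m * 2         ≡⟨ cong (_+ suc m * 2) (shanksExp-double (suc m) m) ⟩
  suc m * m * 2 + m * suc m + suc m * 2       ≡⟨ solve m ⟩
  suc m * (m + 2 * suc m)                     ∎)
  where
  open ≡-Reasoning
  solve : ∀ m → suc m * m * 2 + m * suc m + suc m * 2 ≡ suc m * (m + 2 * suc m)
  solve = ℕ-Solver.solve-∀

-- The truncated pentagonal theorem

module Pochhammer (c : ℕ) where

  -- poch k l f = (q^{c(k+1)}; q^c)_l · f = ∏_{i=k+1}^{k+l} (1 - q^{ci}) · f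
  poch : ℕ → ℕ → Series → Series
  poch k zero    f = f
  poch k (suc l) f = [1-q^ c * suc k ]· poch (suc k) l f

  poch-isShiftLinear : ∀ k l → IsShiftLinear (poch k l)
  poch-isShiftLinear k zero    = id-isShiftLinear
  poch-isShiftLinear k (suc l) = ∘-isShiftLinear ([1-q^]-isShiftLinear (c * suc k)) (poch-isShiftLinear (suc k) l)

  poch-comm : ∀ {O} → IsShiftLinear O → ∀ k l f → poch k l (O f) ≗ O (poch k l f)
  poch-comm isO k zero    f x = refl
  poch-comm isO k (suc l) f x =
    trans (IsShiftLinear.≗-cong ([1-q^]-isShiftLinear (c * suc k)) (poch-comm isO (suc k) l f) x)
          (sym ([1-q^]-comm isO (c * suc k) (poch (suc k) l f) x))

  poch-length-cong : ∀ k {l l′} f → l ≡ l′ → poch k l f ≗ poch k l′ f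
  poch-length-cong k f refl x = refl

  poch-snoc : ∀ k l f → poch k (suc l) f ≗ poch k l ([1-q^ c * suc (k + l) ]· f)
  poch-snoc k zero    f x = cong (λ e → ([1-q^ c * suc e ]· f) x) (sym (ℕₚ.+-identityʳ k))
  poch-snoc k (suc l) f x =
    trans (IsShiftLinear.≗-cong ([1-q^]-isShiftLinear (c * suc k)) (poch-snoc (suc k) l f) x)
          (cong (λ e → poch k (suc l) ([1-q^ c * suc e ]· f) x) (sym (ℕₚ.+-suc k l)))

  poch-last : ∀ k l f → poch k (suc l) f ≗ [1-q^ c * suc (k + l) ]· poch k l f
  poch-last k l f x = trans (poch-snoc k l f x) (poch-comm ([1-q^]-isShiftLinear (c * suc (k + l))) k l f x)

  -- Shanks' identity, with T_k = triangle k: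
  --   ∑_{k=0}^{m} (-1)^k q^{c(mk + T_k)} (q^{c(k+1)}; q^c)_{m-k}
  --     = 1 + ∑_{j=1}^{m} (-1)^j (q^{c j(3j-1)/2} + q^{c j(3j+1)/2}).
  -- From m to m + 1 the terms with k ≤ m change by a telescoping sum of boundary terms.
  shanksTerm : ℕ → ℕ → Series → Series
  shanksTerm m k f x = sign k ℤ.* (q^ c * shanksExp m k · poch k (m ∸ k) f) x

  shanksSum : ℕ → Series → Series
  shanksSum m f x = ∑< (suc m) (λ k → shanksTerm m k f x)

  boundaryTerm : ℕ → Series → ℕ → ℕ → ℤ
  boundaryTerm m f x k = sign (suc k) ℤ.* (q^ c * (shanksExp (suc m) k + suc m) · poch k (m ∸ k) f) x

  private
    suc[k+l]∸k≡suc[l] : ∀ k l → suc (k + l) ∸ k ≡ suc l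
    suc[k+l]∸k≡suc[l] k l = trans (ℕₚ.+-∸-assoc 1 (ℕₚ.m≤m+n k l)) (cong suc (ℕₚ.m+n∸m≡n k l))

  module _ (k l : ℕ) (f : Series) (x : ℕ) where
    private
      m = k + l
      a : ℕ → ℤ
      a e = (q^ e · poch k l f) x

    shanksTerm-suc :
      shanksTerm (suc m) k f x ≡ sign k ℤ.* (a (c * shanksExp (suc m) k) ℤ.- a (c * (shanksExp (suc m) k + suc m)))
    shanksTerm-suc = cong (sign k ℤ.*_) (begin
      (q^ E · poch k (suc m ∸ k) f) x
        ≡⟨ q^-cong E (poch-length-cong k f (suc[k+l]∸k≡suc[l] k l)) x ⟩
      (q^ E · poch k (suc l) f) x
        ≡⟨ q^-cong E (poch-last k l f) x ⟩
      (q^ E · [1-q^ c * suc m ]· poch k l f) x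
        ≡⟨ q^-[1-q^] E (c * suc m) (poch k l f) x ⟩
      a E ℤ.- a (E + c * suc m)
        ≡⟨ cong (λ e → a E ℤ.- a e) (ℕₚ.*-distribˡ-+ c _ (suc m)) ⟨
      a E ℤ.- a (c * (shanksExp (suc m) k + suc m)) ∎)
      where
      open ≡-Reasoning
      E = c * shanksExp (suc m) k

    private
      m∸k≡l : m ∸ k ≡ l
      m∸k≡l = ℕₚ.m+n∸m≡n k l

    shanksTerm-same : shanksTerm m k f x ≡ sign k ℤ.* a (c * shanksExp m k)
    shanksTerm-same = cong (sign k ℤ.*_) (q^-cong (c * shanksExp m k) (poch-length-cong k f m∸k≡l) x)

    boundaryTerm-same : boundaryTerm m f x k ≡ ℤ.- sign k ℤ.* a (c * (shanksExp (suc m) k + suc m))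
    boundaryTerm-same =
      cong (ℤ.- sign k ℤ.*_) (q^-cong (c * (shanksExp (suc m) k + suc m)) (poch-length-cong k f m∸k≡l) x)

  boundaryTerm-prev : ∀ k l f x → let m = suc (k + l) ; a = λ e → (q^ e · poch (suc k) l f) x in
    boundaryTerm m f x k ≡ sign (suc k) ℤ.* (a (c * shanksExp m (suc k)) ℤ.- a (c * shanksExp (suc m) (suc k)))
  boundaryTerm-prev k l f x = cong (sign (suc k) ℤ.*_) (begin
    (q^ X · poch k (m ∸ k) f) x
      ≡⟨ q^-cong X (poch-length-cong k f (suc[k+l]∸k≡suc[l] k l)) x ⟩
    (q^ X · [1-q^ c * suc k ]· A) x
      ≡⟨ q^-[1-q^] X (c * suc k) A x ⟩
    a X ℤ.- a (X + c * suc k)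
      ≡⟨ cong₂ (λ e e′ → a e ℤ.- a e′) X≡ X+ck≡ ⟩
    a (c * shanksExp m (suc k)) ℤ.- a (c * shanksExp (suc m) (suc k)) ∎)
    where
    open ≡-Reasoning
    m = suc (k + l)
    A = poch (suc k) l f
    a = λ e → (q^ e · A) x
    X = c * (shanksExp (suc m) k + suc m)
    X≡ : X ≡ c * shanksExp m (suc k)
    X≡ = cong (c *_) (shanksExp-boundary m k)
    X+ck≡ : X + c * suc k ≡ c * shanksExp (suc m) (suc k)
    X+ck≡ = trans (sym (ℕₚ.*-distribˡ-+ c _ (suc k)))
                  (cong (c *_) (trans (cong (_+ suc k) (shanksExp-boundary m k)) (shanksExp-suc m (suc k))))

  shanksTerm-Δ⁺ : ∀ k l f x →
    shanksTerm (suc (k + l)) k f x ℤ.- shanksTerm (k + l) k f x ≡ Δ (boundaryTerm (k + l) f x) k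
  shanksTerm-Δ⁺ zero l f x = begin
    shanksTerm (suc l) 0 f x ℤ.- shanksTerm l 0 f x
      ≡⟨ cong₂ ℤ._-_ (shanksTerm-suc 0 l f x) (shanksTerm-same 0 l f x) ⟩
    + 1 ℤ.* (a E₁ ℤ.- a E₂) ℤ.- + 1 ℤ.* a (c * shanksExp l 0)
      ≡⟨ cong (λ e → + 1 ℤ.* (a E₁ ℤ.- a E₂) ℤ.- + 1 ℤ.* a (c * e)) (trans (shanksExp-zero l) (sym (shanksExp-zero (suc l))))
      ⟩
    + 1 ℤ.* (a E₁ ℤ.- a E₂) ℤ.- + 1 ℤ.* a E₁
      ≡⟨ cancel (a E₁) (a E₂) ⟩
    ℤ.- + 1 ℤ.* a E₂
      ≡⟨ boundaryTerm-same 0 l f x ⟨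
    boundaryTerm l f x 0 ∎
    where
    open ≡-Reasoning
    a = λ e → (q^ e · poch 0 l f) x
    E₁ = c * shanksExp (suc l) 0
    E₂ = c * (shanksExp (suc l) 0 + suc l)
    cancel : ∀ a₁ a₂ → + 1 ℤ.* (a₁ ℤ.- a₂) ℤ.- + 1 ℤ.* a₁ ≡ ℤ.- + 1 ℤ.* a₂
    cancel = ℤ-Solver.solve-∀
  shanksTerm-Δ⁺ (suc k) l f x = begin
    shanksTerm (suc m) (suc k) f x ℤ.- shanksTerm m (suc k) f x
      ≡⟨ cong₂ ℤ._-_ (shanksTerm-suc (suc k) l f x) (shanksTerm-same (suc k) l f x) ⟩
    s ℤ.* (a E₁ ℤ.- a E₂) ℤ.- s ℤ.* a E₀
      ≡⟨ rearrange s (a E₀) (a E₁) (a E₂) ⟩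
    ℤ.- s ℤ.* a E₂ ℤ.- s ℤ.* (a E₀ ℤ.- a E₁)
      ≡⟨ cong₂ ℤ._-_ (boundaryTerm-same (suc k) l f x) (boundaryTerm-prev k l f x) ⟨
    boundaryTerm m f x (suc k) ℤ.- boundaryTerm m f x k ∎
    where
    open ≡-Reasoning
    m = suc k + l
    s = sign (suc k)
    a = λ e → (q^ e · poch (suc k) l f) x
    E₀ = c * shanksExp m (suc k)
    E₁ = c * shanksExp (suc m) (suc k)
    E₂ = c * (shanksExp (suc m) (suc k) + suc m)
    rearrange : ∀ s a₀ a₁ a₂ →
      s ℤ.* (a₁ ℤ.- a₂) ℤ.- s ℤ.* a₀ ≡ ℤ.- s ℤ.* a₂ ℤ.- s ℤ.* (a₀ ℤ.- a₁)
    rearrange = ℤ-Solver.solve-∀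

  shanksTerm-Δ : ∀ m k f x → k ≤ m →
    shanksTerm (suc m) k f x ℤ.- shanksTerm m k f x ≡ Δ (boundaryTerm m f x) k
  shanksTerm-Δ m k f x k≤m with ℕₚ.m≤n⇒∃[o]m+o≡n k≤m
  ... | l , refl = shanksTerm-Δ⁺ k l f x

  shanksSum-suc : ∀ m f x →
    shanksSum (suc m) f x ≡ shanksSum m f x ℤ.+ boundaryTerm m f x m ℤ.+ shanksTerm (suc m) (suc m) f x
  shanksSum-suc m f x = begin
    shanksSum (suc m) f x
      ≡⟨ ∑<-last (suc m) T′ ⟩
    ∑< (suc m) T′ ℤ.+ T′ (suc m)
      ≡⟨ cong (λ t → t ℤ.+ T′ (suc m)) (split (∑< (suc m) T′) (shanksSum m f x)) ⟩
    shanksSum m f x ℤ.+ (∑< (suc m) T′ ℤ.- ∑< (suc m) T) ℤ.+ T′ (suc m)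
      ≡⟨ cong (λ t → shanksSum m f x ℤ.+ t ℤ.+ T′ (suc m)) differences ⟩
    shanksSum m f x ℤ.+ boundaryTerm m f x m ℤ.+ T′ (suc m) ∎
    where
    open ≡-Reasoning
    T T′ : ℕ → ℤ
    T  k = shanksTerm m k f x
    T′ k = shanksTerm (suc m) k f x
    split : ∀ a b → a ≡ b ℤ.+ (a ℤ.- b)
    split = ℤ-Solver.solve-∀
    differences : ∑< (suc m) T′ ℤ.- ∑< (suc m) T ≡ boundaryTerm m f x m
    differences = begin
      ∑< (suc m) T′ ℤ.- ∑< (suc m) T       ≡⟨ ∑<-- (suc m) T′ T ⟨
      ∑< (suc m) (λ k → T′ k ℤ.- T k)      ≡⟨ ∑<-cong (suc m) (λ k k≤m → shanksTerm-Δ m k f x (s≤s⁻¹ k≤m)) ⟩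
      ∑< (suc m) (Δ (boundaryTerm m f x))  ≡⟨ ∑<-telescope m (boundaryTerm m f x) ⟩
      boundaryTerm m f x m                 ∎

  boundaryTerm-last : ∀ m f x → boundaryTerm m f x m ≡ sign (suc m) ℤ.* (q^ c * pentMinus (suc m) · f) x
  boundaryTerm-last m f x = cong (sign (suc m) ℤ.*_) (trans
    (q^-cong (c * (shanksExp (suc m) m + suc m)) (poch-length-cong m f (ℕₚ.n∸n≡0 m)) x)
    (cong (λ e → (q^ c * e · f) x) (sym (pentMinus≡shanksExp m))))

  shanksTerm-last : ∀ m f x → shanksTerm m m f x ≡ sign m ℤ.* (q^ c * pentPlus m · f) x
  shanksTerm-last m f x = cong (sign m ℤ.*_) (trans
    (q^-cong (c * shanksExp m m) (poch-length-cong m f (ℕₚ.n∸n≡0 m)) x)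
    (cong (λ e → (q^ c * e · f) x) (sym (pentPlus≡shanksExp m))))

  pentagonalTerm : Series → ℕ → ℕ → ℤ
  pentagonalTerm f x j = sign j ℤ.* ((q^ c * pentMinus j · f) x ℤ.+ (q^ c * pentPlus j · f) x)

  shanks : ∀ m f x → shanksSum m f x ≡ f x ℤ.+ sumFrom1 m (pentagonalTerm f x)
  shanks zero    f x = trans (cong (λ e → + 1 ℤ.* (q^ e · f) x ℤ.+ + 0) (ℕₚ.*-zeroʳ c))
                            (cong (λ t → t ℤ.+ + 0) (ℤₚ.*-identityˡ (f x)))
  shanks (suc m) f x = begin
    shanksSum (suc m) f x
      ≡⟨ shanksSum-suc m f x ⟩
    shanksSum m f x ℤ.+ boundaryTerm m f x m ℤ.+ shanksTerm (suc m) (suc m) f x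
      ≡⟨ cong₂ ℤ._+_ (cong₂ ℤ._+_ (shanks m f x) (boundaryTerm-last m f x)) (shanksTerm-last (suc m) f x) ⟩
    f x ℤ.+ sumFrom1 m (pentagonalTerm f x) ℤ.+ s ℤ.* a⁻ ℤ.+ s ℤ.* a⁺
      ≡⟨ regroup (f x) _ s a⁻ a⁺ ⟩
    f x ℤ.+ sumFrom1 (suc m) (pentagonalTerm f x) ∎
    where
    open ≡-Reasoning
    s = sign (suc m)
    a⁻ = (q^ c * pentMinus (suc m) · f) x
    a⁺ = (q^ c * pentPlus (suc m) · f) x
    regroup : ∀ a σ s b b′ → a ℤ.+ σ ℤ.+ s ℤ.* b ℤ.+ s ℤ.* b′ ≡ a ℤ.+ (σ ℤ.+ s ℤ.* (b ℤ.+ b′))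
    regroup = ℤ-Solver.solve-∀

  shanksSum-diagonal : .{{NonZero c}} → ∀ n f → shanksSum n f n ≡ poch 0 n f n
  shanksSum-diagonal n f = begin
    shanksSum n f n
      ≡⟨ cong₂ ℤ._+_ first (∑<-zero n (λ k _ → rest k)) ⟩
    poch 0 n f n ℤ.+ + 0
      ≡⟨ ℤₚ.+-identityʳ _ ⟩
    poch 0 n f n ∎
    where
    open ≡-Reasoning
    first : shanksTerm n 0 f n ≡ poch 0 n f n
    first = trans (cong (λ e → + 1 ℤ.* (q^ c * e · poch 0 n f) n) (shanksExp-zero n))
                  (trans (cong (λ e → + 1 ℤ.* (q^ e · poch 0 n f) n) (ℕₚ.*-zeroʳ c)) (ℤₚ.*-identityˡ _))
    rest : ∀ k → shanksTerm n (suc k) f n ≡ + 0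
    rest k = trans (cong (sign (suc k) ℤ.*_) (q^-< _ n _ beyond)) (ℤₚ.*-zeroʳ (sign (suc k)))
      where
      beyond : n < c * shanksExp n (suc k)
      beyond = ℕₚ.<-≤-trans
        (ℕₚ.<-≤-trans (ℕₚ.m<m+n n (ℕₚ.≤-trans (s≤s z≤n) (ℕₚ.m≤n+m (suc k) (triangle k))))
                      (ℕₚ.+-monoˡ-≤ (triangle (suc k)) (ℕₚ.m≤m*n n (suc k))))
        (ℕₚ.m≤n*m _ c)

  pochhammer-pentagonal : .{{NonZero c}} → ∀ n f → poch 0 n f n ≡ f n ℤ.+ sumFrom1 n (pentagonalTerm f n)
  pochhammer-pentagonal n f = trans (sym (shanksSum-diagonal n f)) (shanks n f n)

-- Counting partitions

𝟙 : {P : Set} → Dec P → ℤ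
𝟙 (yes _) = + 1
𝟙 (no _)  = + 0

𝟙-yes : ∀ {P} (P? : Dec P) → P → 𝟙 P? ≡ + 1
𝟙-yes (yes _) _  = refl
𝟙-yes (no ¬p) p  = ⊥-elim (¬p p)

𝟙-no : ∀ {P} (P? : Dec P) → ¬ P → 𝟙 P? ≡ + 0
𝟙-no (yes p) ¬p = ⊥-elim (¬p p)
𝟙-no (no _)  _  = refl

𝟙-⇔ : ∀ {P Q} (P? : Dec P) (Q? : Dec Q) → (P → Q) → (Q → P) → 𝟙 P? ≡ 𝟙 Q?
𝟙-⇔ (yes p) Q? P→Q Q→P = sym (𝟙-yes Q? (P→Q p))
𝟙-⇔ (no ¬p) Q? P→Q Q→P = sym (𝟙-no Q? (¬p ∘ Q→P))

∑ᴸ : {A : Set} → List A → (A → ℤ) → ℤ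
∑ᴸ []       φ = + 0
∑ᴸ (x ∷ xs) φ = φ x ℤ.+ ∑ᴸ xs φ

∑ᴸ-applyUpTo : ∀ N (f : ℕ → ℕ) φ → ∑ᴸ (applyUpTo f N) φ ≡ ∑< N (φ ∘ f)
∑ᴸ-applyUpTo zero    f φ = refl
∑ᴸ-applyUpTo (suc N) f φ = cong (λ t → φ (f 0) ℤ.+ t) (∑ᴸ-applyUpTo N (f ∘ suc) φ)

∑ᴸ-filter : ∀ {A : Set} {Q : A → Set} (Q? : Decidable Q) xs φ ψ →
  (∀ x → Q x → φ x ≡ ψ x) → (∀ x → ¬ Q x → ψ x ≡ + 0) → ∑ᴸ (filter Q? xs) φ ≡ ∑ᴸ xs ψ
∑ᴸ-filter Q? []       φ ψ φ≡ψ ψ≡0 = refl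
∑ᴸ-filter Q? (x ∷ xs) φ ψ φ≡ψ ψ≡0 with Q? x
... | yes q  = cong₂ ℤ._+_ (φ≡ψ x q) (∑ᴸ-filter Q? xs φ ψ φ≡ψ ψ≡0)
... | no ¬q  = trans (∑ᴸ-filter Q? xs φ ψ φ≡ψ ψ≡0)
                     (sym (trans (cong (ℤ._+ ∑ᴸ xs ψ) (ψ≡0 x ¬q)) (ℤₚ.+-identityˡ _)))

length-filter-concatMap : ∀ {A B : Set} {P : B → Set} (P? : Decidable P) (F : A → List B) xs →
  + length (filter P? (concatMap F xs)) ≡ ∑ᴸ xs (λ x → + length (filter P? (F x)))
length-filter-concatMap P? F []       = refl
length-filter-concatMap P? F (x ∷ xs) = begin
  + length (filter P? (F x ++ concatMap F xs))
    ≡⟨ cong (λ l → + length l) (Listₚ.filter-++ P? (F x) (concatMap F xs)) ⟩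
  + length (filter P? (F x) ++ filter P? (concatMap F xs))
    ≡⟨ cong +_ (Listₚ.length-++ (filter P? (F x))) ⟩
  + (length (filter P? (F x)) + length (filter P? (concatMap F xs)))
    ≡⟨ ℤₚ.pos-+ (length (filter P? (F x))) _ ⟩
  + length (filter P? (F x)) ℤ.+ + length (filter P? (concatMap F xs))
    ≡⟨ cong (λ t → + length (filter P? (F x)) ℤ.+ t) (length-filter-concatMap P? F xs) ⟩
  + length (filter P? (F x)) ℤ.+ ∑ᴸ xs (λ x → + length (filter P? (F x))) ∎
  where open ≡-Reasoning

module Multiplicities (p v r a m : ℕ) (1≤v : 1 ≤ v) where

  c g : ℕ
  c = p * r + a
  g = gcd v p

  Allowed : ℕ → Set
  Allowed = AllowedMult p v r a m

  record AllowedAt (μ j : ℕ) : Set where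
    field
      j<v   : j < v
      ≡ja   : μ ≡ j * a [mod p ]
      lower : j * c ≤ μ
      upper : μ ≤ j * c + p * (m ∸ 1)

  allowed⇒allowedAt : ∀ {μ} → Allowed μ → Σ ℕ (AllowedAt μ)
  allowed⇒allowedAt (j , ≡ja , lower , upper) =
    toℕ j , record { j<v = toℕ<n j ; ≡ja = ≡ja ; lower = lower ; upper = upper }

  allowedAt⇒allowed : ∀ {μ j} → AllowedAt μ j → Allowed μ
  allowedAt⇒allowed {μ} record { j<v = j<v ; ≡ja = ≡ja ; lower = lower ; upper = upper } =
    fromℕ< j<v , subst (λ j → (μ ≡ j * a [mod p ]) × (j * c ≤ μ) × (μ ≤ j * c + p * (m ∸ 1)))
                       (sym (toℕ-fromℕ< j<v)) (≡ja , lower , upper)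

  allowed-zero : Allowed 0
  allowed-zero = allowedAt⇒allowed {j = 0} record { j<v = 1≤v ; ≡ja = p ∣0 ; lower = z≤n ; upper = z≤n }

  -- Since c ≡ a (mod p), raising the multiplicity by c moves the congruence class from j·a to (j+1)·a.
  c+μ-[1+j]a : ∀ μ j → + (c + μ) ℤ.- + (suc j * a) ≡ + (p * r) ℤ.+ (+ μ ℤ.- + (j * a))
  c+μ-[1+j]a μ j rewrite ℤₚ.pos-+ (p * r + a) μ | ℤₚ.pos-+ (p * r) a | ℤₚ.pos-+ a (j * a) =
    solve (+ (p * r)) (+ a) (+ μ) (+ (j * a))
    where
    solve : ∀ pr a μ ja → pr ℤ.+ a ℤ.+ μ ℤ.- (a ℤ.+ ja) ≡ pr ℤ.+ (μ ℤ.- ja)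
    solve = ℤ-Solver.solve-∀

  mod⇒∣ : ∀ μ j → μ ≡ j * a [mod p ] → + p ℤ∣.∣ (+ μ ℤ.- + (j * a))
  mod⇒∣ μ j = ℤ∣.∣ᵤ⇒∣ {i = + μ ℤ.- + (j * a)}

  p∣pr : + p ℤ∣.∣ + (p * r)
  p∣pr = subst (+ p ℤ∣.∣_) (sym (ℤₚ.pos-* p r)) (ℤ∣.∣m⇒∣m*n (+ r) ℤ∣.∣-refl)

  allowedAt-pred : ∀ {μ j} → AllowedAt (c + μ) (suc j) → AllowedAt μ j
  allowedAt-pred {μ} {j} A = record
    { j<v   = ℕₚ.<-trans (ℕₚ.n<1+n j) j<v
    ; ≡ja   = ℤ∣.∣⇒∣ᵤ {i = + μ ℤ.- + (j * a)}
                (ℤ∣.∣m+n∣m⇒∣n (subst (+ p ℤ∣.∣_) (c+μ-[1+j]a μ j) (mod⇒∣ (c + μ) (suc j) ≡ja)) p∣pr)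
    ; lower = ℕₚ.+-cancelˡ-≤ c _ _ lower
    ; upper = ℕₚ.+-cancelˡ-≤ c _ _ (subst (c + μ ≤_) (ℕₚ.+-assoc c (j * c) _) upper)
    }
    where open AllowedAt A

  allowedAt-suc : ∀ {μ j} → AllowedAt μ j → suc j < v → AllowedAt (c + μ) (suc j)
  allowedAt-suc {μ} {j} A 1+j<v = record
    { j<v   = 1+j<v
    ; ≡ja   = ℤ∣.∣⇒∣ᵤ (subst (+ p ℤ∣.∣_) (sym (c+μ-[1+j]a μ j)) (ℤ∣.∣m∣n⇒∣m+n p∣pr (mod⇒∣ μ j ≡ja)))
    ; lower = ℕₚ.+-monoʳ-≤ c lower
    ; upper = subst (c + μ ≤_) (sym (ℕₚ.+-assoc c (j * c) _)) (ℕₚ.+-monoʳ-≤ c upper)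
    }
    where open AllowedAt A

  -- For j = v - 1 we have c + μ ≡ v·a (mod p), and g divides both p and v·a.
  allowedAt-last : ∀ {μ j} → AllowedAt μ j → suc j ≡ v → g ∣ c + μ
  allowedAt-last {μ} {j} A refl =
    ℤ∣.∣⇒∣ᵤ (subst (+ g ℤ∣.∣_) (sym c+μ≡) (ℤ∣.∣m∣n⇒∣m+n (ℤ∣.∣m∣n⇒∣m+n g∣pr g∣μ-ja) g∣va))
    where
    open AllowedAt A
    g∣p : + g ℤ∣.∣ + p
    g∣p = ℤ∣.∣ᵤ⇒∣ (gcd[m,n]∣n v p)
    g∣pr = ℤ∣.∣-trans g∣p p∣pr
    g∣μ-ja = ℤ∣.∣-trans g∣p (mod⇒∣ μ j ≡ja)
    g∣va : + g ℤ∣.∣ + (suc j * a)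
    g∣va = subst (+ g ℤ∣.∣_) (sym (ℤₚ.pos-* (suc j) a))
                 (ℤ∣.∣m⇒∣m*n (+ a) (ℤ∣.∣ᵤ⇒∣ {i = + suc j} (gcd[m,n]∣m v p)))
    c+μ≡ : + (c + μ) ≡ (+ (p * r) ℤ.+ (+ μ ℤ.- + (j * a))) ℤ.+ + (suc j * a)
    c+μ≡ = trans (sym (minus-plus (+ (c + μ)) (+ (suc j * a))))
                 (cong (λ t → t ℤ.+ + (suc j * a)) (c+μ-[1+j]a μ j))
      where
      minus-plus : ∀ x y → x ℤ.- y ℤ.+ y ≡ x
      minus-plus = ℤ-Solver.solve-∀

  allowedAt-zero : ∀ {μ} → AllowedAt μ 0 → g ∣ μ
  allowedAt-zero {μ} A = ∣-trans (gcd[m,n]∣n v p) (subst (p ∣_) (ℕₚ.+-identityʳ μ) (AllowedAt.≡ja A))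

  allowedAt-suc-≥ : ∀ {μ j} → AllowedAt μ (suc j) → c ≤ μ
  allowedAt-suc-≥ A = ℕₚ.≤-trans (ℕₚ.m≤m+n c _) (AllowedAt.lower A)

  allowed-c+⇒allowed : ∀ {μ} → ¬ g ∣ c + μ → Allowed (c + μ) → Allowed μ
  allowed-c+⇒allowed g∤c+μ A with allowed⇒allowedAt A
  ... | zero  , A₀ = ⊥-elim (g∤c+μ (allowedAt-zero A₀))
  ... | suc j , Aⱼ = allowedAt⇒allowed (allowedAt-pred Aⱼ)

  allowed⇒allowed-c+ : ∀ {μ} → ¬ g ∣ c + μ → Allowed μ → Allowed (c + μ)
  allowed⇒allowed-c+ g∤c+μ A with allowed⇒allowedAt A
  ... | j , Aⱼ with suc j <? v
  ...   | yes 1+j<v = allowedAt⇒allowed (allowedAt-suc Aⱼ 1+j<v)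
  ...   | no  1+j≮v =
    ⊥-elim (g∤c+μ (allowedAt-last Aⱼ (ℕₚ.≤-antisym (AllowedAt.j<v Aⱼ) (ℕₚ.≮⇒≥ 1+j≮v))))

  forbidden-< : ∀ {μ} → μ < c → ¬ g ∣ μ → ¬ Allowed μ
  forbidden-< μ<c g∤μ A with allowed⇒allowedAt A
  ... | zero  , A₀ = g∤μ (allowedAt-zero A₀)
  ... | suc j , Aⱼ = ℕₚ.<⇒≱ μ<c (allowedAt-suc-≥ Aⱼ)

  allowed? : ∀ μ → Dec (Allowed μ)
  allowed? = allowedMult? p v r a m

  weight : Series
  weight μ = 𝟙 (allowed? μ)

  [1-q^c]-weight-supported : SupportedOnMultiplesOf g ([1-q^ c ]· weight)
  [1-q^c]-weight-supported t g∤t with c ≤? t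
  ... | no  c≰t = cong₂ ℤ._-_ (𝟙-no (allowed? t) (forbidden-< t<c g∤t)) (q^-< c t weight t<c)
    where
    t<c = ℕₚ.≰⇒> c≰t
  ... | yes c≤t with ℕₚ.m≤n⇒∃[o]m+o≡n c≤t
  ...   | μ , refl = begin
    weight (c + μ) ℤ.- (q^ c · weight) (c + μ)  ≡⟨ cong (λ t → weight (c + μ) ℤ.- t) (q^-≤ c (c + μ) weight c≤t) ⟩
    weight (c + μ) ℤ.- weight (c + μ ∸ c)       ≡⟨ cong (λ t → weight (c + μ) ℤ.- weight t) (ℕₚ.m+n∸m≡n c μ) ⟩
    weight (c + μ) ℤ.- weight μ                 ≡⟨ cong (ℤ._- weight μ) periodic ⟩
    weight μ ℤ.- weight μ                       ≡⟨ ℤₚ.+-inverseʳ (weight μ) ⟩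
    + 0                                         ∎
    where
    open ≡-Reasoning
    periodic : weight (c + μ) ≡ weight μ
    periodic = 𝟙-⇔ (allowed? (c + μ)) (allowed? μ) (allowed-c+⇒allowed g∤t) (allowed⇒allowed-c+ g∤t)

  ok? : ∀ {k} (μs : Vec ℕ k) → Dec (AllMultsOK Allowed μs)
  ok? = allMultsOK? allowed?

  ok-head : ∀ {k μ} {μs : Vec ℕ k} → AllMultsOK Allowed (μ ∷ μs) → Allowed μ
  ok-head (zero∷ _)  = allowed-zero
  ok-head (ok∷ A _)  = A

  ok-tail : ∀ {k μ} {μs : Vec ℕ k} → AllMultsOK Allowed (μ ∷ μs) → AllMultsOK Allowed μs
  ok-tail (zero∷ ok) = ok
  ok-tail (ok∷ _ ok) = ok

  ok-cons : ∀ {k μ} {μs : Vec ℕ k} → Allowed μ → AllMultsOK Allowed μs → AllMultsOK Allowed (μ ∷ μs)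
  ok-cons {μ = zero}  _ ok = zero∷ ok
  ok-cons {μ = suc _} A ok = ok∷ A ok

  count-∷-allowed : ∀ {k μ} → Allowed μ → (L : List (Vec ℕ k)) →
    length (filter ok? (map (μ ∷_) L)) ≡ length (filter ok? L)
  count-∷-allowed     A []       = refl
  count-∷-allowed {μ = μ} A (μs ∷ L) with ok? μs
  ... | yes ok = trans (cong length (Listₚ.filter-accept ok? {x = μ ∷ μs} {xs = map (μ ∷_) L} (ok-cons A ok)))
                       (cong suc (count-∷-allowed A L))
  ... | no ¬ok = trans (cong length (Listₚ.filter-reject ok? {x = μ ∷ μs} {xs = map (μ ∷_) L} (¬ok ∘ ok-tail)))
                       (count-∷-allowed A L)

  count-∷-forbidden : ∀ {k μ} → ¬ Allowed μ → (L : List (Vec ℕ k)) →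
    length (filter ok? (map (μ ∷_) L)) ≡ 0
  count-∷-forbidden ¬A []       = refl
  count-∷-forbidden {μ = μ} ¬A (μs ∷ L) =
    trans (cong length (Listₚ.filter-reject ok? {x = μ ∷ μs} {xs = map (μ ∷_) L} (¬A ∘ ok-head)))
          (count-∷-forbidden ¬A L)

  count-∷ : ∀ {k} μ (L : List (Vec ℕ k)) →
    + length (filter ok? (map (μ ∷_) L)) ≡ weight μ ℤ.* + length (filter ok? L)
  count-∷ μ L with allowed? μ
  ... | yes A = trans (cong +_ (count-∷-allowed A L)) (sym (ℤₚ.*-identityˡ _))
  ... | no ¬A = cong +_ (count-∷-forbidden ¬A L)

  -- count k is the coefficient series of ∏_{i=1}^{k} W(q^i), where W = ∑ weight μ q^μ.
  count : ℕ → Series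
  count k x = + length (filter ok? (multVecs k x))

  count-suc : ∀ k → count (suc k) ≗ weight ⟨q^ suc k ⟩· count k
  count-suc k x = begin
    count (suc k) x
      ≡⟨ length-filter-concatMap ok? F (filter fits? (upTo (suc x))) ⟩
    ∑ᴸ (filter fits? (upTo (suc x))) (λ μ → + length (filter ok? (F μ)))
      ≡⟨ ∑ᴸ-filter fits? (upTo (suc x)) _ term fitting unfitting ⟩
    ∑ᴸ (upTo (suc x)) term
      ≡⟨ ∑ᴸ-applyUpTo (suc x) (λ μ → μ) term ⟩
    (weight ⟨q^ suc k ⟩· count k) x ∎
    where
    open ≡-Reasoning
    F : ℕ → List (Vec ℕ (suc k))
    F μ = map (μ ∷_) (multVecs k (x ∸ suc k * μ))
    fits? : ∀ μ → Dec (suc k * μ ≤ x)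
    fits? μ = suc k * μ ≤? x
    term : ℕ → ℤ
    term μ = weight μ ℤ.* (q^ suc k * μ · count k) x
    fitting : ∀ μ → suc k * μ ≤ x → + length (filter ok? (F μ)) ≡ term μ
    fitting μ fits = trans (count-∷ μ (multVecs k (x ∸ suc k * μ)))
                           (cong (weight μ ℤ.*_) (sym (q^-≤ (suc k * μ) x (count k) fits)))
    unfitting : ∀ μ → ¬ suc k * μ ≤ x → term μ ≡ + 0
    unfitting μ ¬fits = trans (cong (weight μ ℤ.*_) (q^-< (suc k * μ) x (count k) (ℕₚ.≰⇒> ¬fits)))
                              (ℤₚ.*-zeroʳ (weight μ))

  count-stable : ∀ k y → y ≤ k → count (suc k) y ≡ count k y
  count-stable k y y≤k = begin
    count (suc k) y
      ≡⟨ count-suc k y ⟩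
    weight 0 ℤ.* (q^ suc k * 0 · count k) y ℤ.+ ∑< y (λ μ → weight (suc μ) ℤ.* (q^ suc k * suc μ · count k) y)
      ≡⟨ cong₂ ℤ._+_ only-μ≡0 (∑<-zero y (λ μ _ → positive-μ μ)) ⟩
    count k y ℤ.+ + 0
      ≡⟨ ℤₚ.+-identityʳ (count k y) ⟩
    count k y ∎
    where
    open ≡-Reasoning
    only-μ≡0 : weight 0 ℤ.* (q^ suc k * 0 · count k) y ≡ count k y
    only-μ≡0 = trans (cong₂ ℤ._*_ (𝟙-yes (allowed? 0) allowed-zero)
                                  (cong (λ e → (q^ e · count k) y) (ℕₚ.*-zeroʳ (suc k))))
                     (ℤₚ.*-identityˡ (count k y))
    positive-μ : ∀ μ → weight (suc μ) ℤ.* (q^ suc k * suc μ · count k) y ≡ + 0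
    positive-μ μ = trans (cong (weight (suc μ) ℤ.*_) (q^-< _ y (count k) y<k[1+μ])) (ℤₚ.*-zeroʳ (weight (suc μ)))
      where
      y<k[1+μ] : y < suc k * suc μ
      y<k[1+μ] = ℕₚ.≤-trans (s≤s y≤k) (ℕₚ.m≤m*n (suc k) (suc μ))

  count-≥ : ∀ {k y} → y ≤ k → count k y ≡ + b p v r a m y
  count-≥ {k} {y} y≤k with ℕₚ.m≤n⇒∃[o]m+o≡n y≤k
  ... | d , refl = count-y+ d
    where
    count-y+ : ∀ d → count (y + d) y ≡ + b p v r a m y
    count-y+ zero    = cong (λ k → count k y) (ℕₚ.+-identityʳ y)
    count-y+ (suc d) = trans (cong (λ k → count k y) (ℕₚ.+-suc y d))
                             (trans (count-stable (y + d) y (ℕₚ.m≤m+n y d)) (count-y+ d))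

  q^-count : ∀ n s → (q^ s · count n) n ≡ + bℤ p v r a m (+ n ℤ.- + s)
  q^-count n s with s ≤? n
  ... | yes s≤n = begin
    (q^ s · count n) n               ≡⟨ q^-≤ s n (count n) s≤n ⟩
    count n (n ∸ s)                  ≡⟨ count-≥ (ℕₚ.m∸n≤m n s) ⟩
    + b p v r a m (n ∸ s)            ≡⟨ cong (λ z → + bℤ p v r a m z) (trans (ℤₚ.m-n≡m⊖n n s) (ℤₚ.⊖-≥ s≤n)) ⟨
    + bℤ p v r a m (+ n ℤ.- + s)     ∎
    where open ≡-Reasoning
  ... | no  s≰n = trans (q^-< s n (count n) n<s) (cong (λ z → + bℤ p v r a m z) (sym negative))
    where
    n<s = ℕₚ.≰⇒> s≰n
    negative : + n ℤ.- + s ≡ ℤ.-[1+ s ∸ suc n ]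
    negative = trans (ℤₚ.m-n≡m⊖n n s) (trans (ℤₚ.⊖-< n<s) (cong (λ t → ℤ.- + t) (ℕₚ.+-∸-assoc 1 n<s)))

  open Pochhammer c

  poch-count-supported : ∀ N → SupportedOnMultiplesOf g (poch 0 N (count N))
  poch-count-supported zero    zero    g∤0 = ⊥-elim (g∤0 (g ∣0))
  poch-count-supported zero    (suc x) _   = refl
  poch-count-supported (suc N) x       g∤x = begin
    poch 0 (suc N) (count (suc N)) x
      ≡⟨ IsShiftLinear.≗-cong (poch-isShiftLinear 0 (suc N)) (count-suc N) x ⟩
    poch 0 (suc N) (weight ⟨q^ suc N ⟩· count N) x
      ≡⟨ poch-snoc 0 N (weight ⟨q^ suc N ⟩· count N) x ⟩
    poch 0 N ([1-q^ c * suc N ]· weight ⟨q^ suc N ⟩· count N) x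
      ≡⟨ IsShiftLinear.≗-cong (poch-isShiftLinear 0 N) ([1-q^]-dilate weight c N (count N)) x ⟩
    poch 0 N (([1-q^ c ]· weight) ⟨q^ suc N ⟩· count N) x
      ≡⟨ poch-comm (dilate-isShiftLinear ([1-q^ c ]· weight) N) 0 N (count N) x ⟩
    (([1-q^ c ]· weight) ⟨q^ suc N ⟩· poch 0 N (count N)) x
      ≡⟨ dilate-supported (suc N) [1-q^c]-weight-supported (poch-count-supported N) x g∤x ⟩
    + 0 ∎
    where open ≡-Reasoning

  pentagonal-recurrence : .{{NonZero c}} → ∀ n → ¬ g ∣ n →
    + b p v r a m n ℤ.+ sumFrom1 n (pentagonalTerm (count n) n) ≡ + 0
  pentagonal-recurrence n g∤n = trans (sym (pochhammer-pentagonal n (count n))) (poch-count-supported n n g∤n)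

sumFrom1-cong : ∀ n {φ ψ : ℕ → ℤ} → (∀ j → φ j ≡ ψ j) → sumFrom1 n φ ≡ sumFrom1 n ψ
sumFrom1-cong zero    φ≡ψ = refl
sumFrom1-cong (suc n) φ≡ψ = cong₂ ℤ._+_ (sumFrom1-cong n φ≡ψ) (φ≡ψ (suc n))

neg-sumFrom1 : ∀ n φ → ℤ.- sumFrom1 n φ ≡ sumFrom1 n (λ j → ℤ.- φ j)
neg-sumFrom1 zero    φ = refl
neg-sumFrom1 (suc n) φ =
  trans (ℤₚ.neg-distrib-+ (sumFrom1 n φ) (φ (suc n))) (cong (ℤ._+ ℤ.- φ (suc n)) (neg-sumFrom1 n φ))

x+y≡0⇒x≡-y : ∀ {x y} → x ℤ.+ y ≡ + 0 → x ≡ ℤ.- y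
x+y≡0⇒x≡-y {x} {y} x+y≡0 =
  trans (sym (cancel x y)) (trans (cong (ℤ._- y) x+y≡0) (ℤₚ.+-identityˡ (ℤ.- y)))
  where
  cancel : ∀ x y → x ℤ.+ y ℤ.- y ≡ x
  cancel = ℤ-Solver.solve-∀

theorem5 : (p a r m v n : ℕ) →
    0 < p → 0 < a → gcd a p ≡ 1 → 1 ≤ m → 1 ≤ v → v ≤ p →
    ¬ (gcd v p ∣ n) →
    + (b p v r a m n) ≡
    sumFrom1 n (λ j → sign (suc j) ℤ.*
    (+ (bℤ p v r a m (+ n ℤ.- + ((p *ℕ r +ℕ a) *ℕ pentMinus j)))
    ℤ.+ + (bℤ p v r a m (+ n ℤ.- + ((p *ℕ r +ℕ a) *ℕ pentPlus j)))))
theorem5 p a r m v n _ 0<a _ _ 1≤v _ g∤n = begin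
  + b p v r a m n                                        ≡⟨ x+y≡0⇒x≡-y (pentagonal-recurrence n g∤n) ⟩
  ℤ.- sumFrom1 n (pentagonalTerm (count n) n)            ≡⟨ neg-sumFrom1 n _ ⟩
  sumFrom1 n (λ j → ℤ.- pentagonalTerm (count n) n j)    ≡⟨ sumFrom1-cong n term ⟩
  sumFrom1 n (λ j → sign (suc j) ℤ.* (B (pentMinus j) ℤ.+ B (pentPlus j))) ∎
  where
  open ≡-Reasoning
  open Multiplicities p v r a m 1≤v
  open Pochhammer c
  instance
    c≢0 : NonZero c
    c≢0 = >-nonZero (ℕₚ.<-≤-trans 0<a (ℕₚ.m≤n+m a (p * r)))
  B : ℕ → ℤ
  B e = + bℤ p v r a m (+ n ℤ.- + (c * e))
  term : ∀ j → ℤ.- pentagonalTerm (count n) n j ≡ sign (suc j) ℤ.* (B (pentMinus j) ℤ.+ B (pentPlus j))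
  term j = trans (ℤₚ.neg-distribˡ-* (sign j) _)
                 (cong (sign (suc j) ℤ.*_) (cong₂ ℤ._+_ (q^-count n (c * pentMinus j)) (q^-count n (c * pentPlus j))))
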